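{- Let $G = (V,E)$ be an $r$-regular graph with $r \geq 28$. Then $V$ can be partitioned as $V = U_1 \cup U_2$ so that every vertex $v \in V$ has at least $0.11 r$ neighbours in $U_1$ and at least $0.11 r$ neighbours in $U_2$. -}

module Defs where

open import Data.Nat using (ℕ)
open import Data.Bool using (Bool; true; false; _∧_; not)
open import Data.Fin using (Fin)
open import Data.Vec.Functional using (Vector)
open import Data.Vec using (count; tabulate)
open import Relation.Binary.PropositionalEquality using (_≡_)
open import Data.Bool.Properties using (T?)

record SimpleGraph (n : ℕ) : Set where
  field
    adj       : Fin n → Fin n → Bool
    symmetric : ∀ i j → adj i j ≡ adj j i
    loopless  : ∀ i → adj i i ≡ false
open SimpleGraph public

countWhere : ∀ {n} → (Fin n → Bool) → ℕ
countWhere {n} p = count (λ b → T? b) (tabulate p)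

degree : ∀ {n} → SimpleGraph n → Fin n → ℕ
degree G v = countWhere (adj G v)

neighboursIn : ∀ {n} → SimpleGraph n → (Fin n → Bool) → Fin n → ℕ
neighboursIn G U v = countWhere (λ j → adj G v j ∧ U j)

Regular : ∀ {n} → SimpleGraph n → ℕ → Set
Regular G r = ∀ v → degree G v ≡ r

-- Colour the vertices independently and uniformly at random, and call v lopsided if fewer than
-- 0.11 r of its neighbours have one of the two colours. For a colour b, Markov's inequality for
-- (49/50)^(100 X), X the number of neighbours of v of colour b, bounds the probability of
-- X < 0.11 r by (α/β)^r, which is at most 1/(8r²) once r ≥ 28. Whether v is lopsided depends
-- only on the colours of its neighbours, so this event is independent of those of all but the
-- at most r² vertices sharing a neighbour with v, and the symmetric local lemma (probability
-- ≤ 1/(4D), dependency degree ≤ D) yields a colouring without lopsided vertices. Probabilities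
-- are counts of colourings throughout; the local lemma is proved by the usual induction on S:
-- 2D · Pr[Aᵢ ∧ no Aⱼ, j ∈ S] ≤ Pr[no Aⱼ, j ∈ S].

module Submission where

open import Defs
open import Data.Bool using (Bool; true; false; not; _∧_; _∨_; if_then_else_) renaming (T to IsTrue)
open import Data.Bool.Properties
  using (∧-conicalˡ; ∧-conicalʳ; ∧-zeroʳ; ∧-identityʳ; ∧-comm; ∨-conicalˡ; ∨-conicalʳ;
         not-involutive)
open import Data.Fin using (Fin; zero; suc)
open import Data.Fin.Properties using (_≟_)
open import Data.Nat
  using (ℕ; zero; suc; _+_; _*_; _^_; _∸_; _≤_; _<_; _<ᵇ_; z≤n; s≤s;
         NonZero; >-nonZero; >-nonZero⁻¹; +-rawMagma)
open import Data.Nat.Properties hiding (_≟_)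
open import Data.Product using (Σ; _×_; _,_; proj₁; proj₂)
open import Data.Sum using (_⊎_; inj₁; inj₂)
open import Data.Vec.Functional using (_∷_)
open import Function using (_∘_; case_of_)
open import Data.Nat.Tactic.RingSolver using (solve-∀)
open import Algebra.Properties.CommutativeSemigroup +-commutativeSemigroup
  using () renaming (interchange to [m+n]+[o+p]≡[m+o]+[n+p])
open import Algebra.Properties.CommutativeSemigroup *-commutativeSemigroup
  using () renaming (x∙yz≈y∙xz to m*[n*o]≡n*[m*o])
open import Relation.Nullary using (yes; no; does; contradiction)
open import Relation.Nullary.Decidable using (dec-true)
open import Relation.Binary.PropositionalEquality
open import Induction.WellFounded using (module All)
open import Data.Nat.Induction using (<-wellFounded)
import Relation.Binary.Construct.On as On
open import Level using (0ℓ)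
open import Algebra.Definitions.RawMagma +-rawMagma using (_,_)

private
  variable
    A : Set

-- Finite sets as Boolean predicates

infix 4 _⊆_
infixr 7 _∩_
infixr 6 _∪_

_⊆_ : (A → Bool) → (A → Bool) → Set
P ⊆ Q = ∀ x → P x ≡ true → Q x ≡ true

_∩_ _∪_ : (A → Bool) → (A → Bool) → A → Bool
(P ∩ Q) x = P x ∧ Q x
(P ∪ Q) x = P x ∨ Q x

∁ : (A → Bool) → A → Bool
∁ P x = not (P x)

∩-⊆ˡ : (P Q : A → Bool) → P ∩ Q ⊆ P
∩-⊆ˡ P Q x = ∧-conicalˡ (P x) (Q x)

∩-⊆ʳ : (P Q : A → Bool) → P ∩ Q ⊆ Q
∩-⊆ʳ P Q x = ∧-conicalʳ (P x) (Q x)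

∪-⊆ : {P Q R : A → Bool} → P ⊆ R → Q ⊆ R → P ∪ Q ⊆ R
∪-⊆ {P = P} P⊆R Q⊆R x PQx with P x in Px
... | true  = P⊆R x Px
... | false = Q⊆R x PQx

⊆-∪ˡ : (P Q : A → Bool) → P ⊆ P ∪ Q
⊆-∪ˡ P Q x Px rewrite Px = refl

∩-monoʳ : (P : A → Bool) {Q R : A → Bool} → Q ⊆ R → P ∩ Q ⊆ P ∩ R
∩-monoʳ P Q⊆R x PQx with P x
... | true = Q⊆R x PQx

⊆-∩∁∪∩ : (S O : A → Bool) → S ⊆ (S ∩ ∁ O) ∪ (S ∩ O)
⊆-∩∁∪∩ S O x Sx rewrite Sx with O x
... | true  = refl
... | false = refl

∩-⊆-∁∩∁ : (S O : A → Bool) → S ∩ O ⊆ ∁ (S ∩ ∁ O)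
∩-⊆-∁∩∁ S O x SOx rewrite ∩-⊆ˡ S O x SOx | ∩-⊆ʳ S O x SOx = refl

not≡true : ∀ {a} → not a ≡ true → a ≡ false
not≡true {false} _ = refl

∧-cong-guarded : ∀ a {x y} → (a ≡ true → x ≡ y) → a ∧ x ≡ a ∧ y
∧-cong-guarded true  x≡y = x≡y refl
∧-cong-guarded false _   = refl

bit : Bool → ℕ
bit true  = 1
bit false = 0

bit≤1 : ∀ a → bit a ≤ 1
bit≤1 true  = ≤-refl
bit≤1 false = z≤n

bit>0 : ∀ {a} → 0 < bit a → a ≡ true
bit>0 {true} _ = refl

bit-mono : ∀ {a b} → (a ≡ true → b ≡ true) → bit a ≤ bit b
bit-mono {false} _   = z≤n
bit-mono {true}  a⇒b rewrite a⇒b refl = ≤-refl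

bit-∨ : ∀ a b → bit (a ∨ b) ≤ bit a + bit b
bit-∨ true  _ = s≤s z≤n
bit-∨ false _ = ≤-refl

bit-∧ : ∀ a b → bit (a ∧ b) ≡ bit a * bit b
bit-∧ true  b = sym (+-identityʳ (bit b))
bit-∧ false b = refl

bit-split : ∀ a b → bit b ≡ bit (a ∧ b) + bit (not a ∧ b)
bit-split true  b = sym (+-identityʳ _)
bit-split false b = refl

size : ∀ {n} → (Fin n → Bool) → ℕ
size {zero}  P = 0
size {suc n} P = bit (P zero) + size (P ∘ suc)

countWhere≡size : ∀ {n} (P : Fin n → Bool) → countWhere P ≡ size P
countWhere≡size {zero}  P = refl
countWhere≡size {suc n} P with P zero
... | true  = cong suc (countWhere≡size (P ∘ suc))
... | false = countWhere≡size (P ∘ suc)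

size-cong : ∀ {n} {P Q : Fin n → Bool} → (∀ j → P j ≡ Q j) → size P ≡ size Q
size-cong {zero}  _   = refl
size-cong {suc n} P≗Q = cong₂ _+_ (cong bit (P≗Q zero)) (size-cong (P≗Q ∘ suc))

size-mono : ∀ {n} {P Q : Fin n → Bool} → P ⊆ Q → size P ≤ size Q
size-mono {zero}  _   = z≤n
size-mono {suc n} P⊆Q = +-mono-≤ (bit-mono (P⊆Q zero)) (size-mono (P⊆Q ∘ suc))

size-∪ : ∀ {n} (P Q : Fin n → Bool) → size (P ∪ Q) ≤ size P + size Q
size-∪ {zero}  P Q = z≤n
size-∪ {suc n} P Q = begin
  bit (P zero ∨ Q zero) + size ((P ∘ suc) ∪ (Q ∘ suc))
    ≤⟨ +-mono-≤ (bit-∨ (P zero) (Q zero)) (size-∪ (P ∘ suc) (Q ∘ suc)) ⟩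
  (bit (P zero) + bit (Q zero)) + (size (P ∘ suc) + size (Q ∘ suc))
    ≡⟨ [m+n]+[o+p]≡[m+o]+[n+p] (bit (P zero)) _ _ _ ⟩
  (bit (P zero) + size (P ∘ suc)) + (bit (Q zero) + size (Q ∘ suc)) ∎
  where open ≤-Reasoning

size-∅ : ∀ {n} → size {n} (λ _ → false) ≡ 0
size-∅ {zero}  = refl
size-∅ {suc n} = size-∅ {n}

size≡0 : ∀ {n} (P : Fin n → Bool) → size P ≡ 0 → ∀ j → P j ≡ false
size≡0 {suc n} P ∣P∣≡0 j with P zero in P₀
size≡0 {suc n} P ∣P∣≡0 zero    | false = P₀
size≡0 {suc n} P ∣P∣≡0 (suc j) | false = size≡0 (P ∘ suc) ∣P∣≡0 j

size>0 : ∀ {n} (P : Fin n → Bool) → 0 < size P → Σ (Fin n) (λ j → P j ≡ true)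
size>0 {suc n} P ∣P∣>0 with P zero in P₀
... | true  = zero , P₀
... | false = let (j , Pj) = size>0 (P ∘ suc) ∣P∣>0 in suc j , Pj

_─_ : ∀ {n} → (Fin n → Bool) → Fin n → Fin n → Bool
(P ─ j) x = P x ∧ not (does (x ≟ j))

─-⊆ : ∀ {n} (P : Fin n → Bool) j → P ─ j ⊆ P
─-⊆ P j x = ∧-conicalˡ (P x) _

─-self : ∀ {n} (P : Fin n → Bool) j → (P ─ j) j ≡ false
─-self P j rewrite dec-true (j ≟ j) refl = ∧-zeroʳ (P j)

─-cover : ∀ {n} (P : Fin n → Bool) j x → P x ≡ true → (P ─ j) x ≡ true ⊎ x ≡ j
─-cover P j x Px with x ≟ j
... | yes x≡j = inj₂ x≡j
... | no  _   rewrite Px = inj₁ refl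

size-─ : ∀ {n} (P : Fin n → Bool) j → P j ≡ true → suc (size (P ─ j)) ≡ size P
size-─ {suc n} P zero    Pj rewrite Pj =
  cong suc (size-cong (λ x → ∧-identityʳ (P (suc x))))
size-─ {suc n} P (suc j) Pj rewrite ∧-identityʳ (P zero) =
  trans (sym (+-suc (bit (P zero)) _)) (cong (bit (P zero) +_) (size-─ (P ∘ suc) j Pj))

size-< : ∀ {n} {P Q : Fin n → Bool} j → P ⊆ Q → P j ≡ false → Q j ≡ true → size P < size Q
size-< {P = P} {Q} j P⊆Q Pj Qj = begin-strict
  size P       ≤⟨ size-mono P⊆Q─j ⟩
  size (Q ─ j) <⟨ ≤-reflexive (size-─ Q j Qj) ⟩
  size Q       ∎
  where
  open ≤-Reasoning
  P⊆Q─j : P ⊆ Q ─ j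
  P⊆Q─j x Px with x ≟ j
  ... | yes refl = contradiction (trans (sym Pj) Px) λ ()
  ... | no  _    rewrite P⊆Q x Px = refl

size-induction : ∀ {n} (P : (Fin n → Bool) → Set) →
                 (∀ S → (∀ {T} → size T < size S → P T) → P S) → ∀ S → P S
size-induction P = All.wfRec (On.wellFounded size <-wellFounded) 0ℓ P

exists : ∀ {n} → (Fin n → Bool) → Bool
exists {zero}  P = false
exists {suc n} P = P zero ∨ exists (P ∘ suc)

exists-false⁻ : ∀ {n} (P : Fin n → Bool) → exists P ≡ false → ∀ j → P j ≡ false
exists-false⁻ P ∄P zero    = ∨-conicalˡ (P zero) _ ∄P
exists-false⁻ P ∄P (suc j) = exists-false⁻ (P ∘ suc) (∨-conicalʳ (P zero) _ ∄P) j

exists-false⁺ : ∀ {n} (P : Fin n → Bool) → (∀ j → P j ≡ false) → exists P ≡ false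
exists-false⁺ {zero}  P _   = refl
exists-false⁺ {suc n} P P≡∅ rewrite P≡∅ zero = exists-false⁺ (P ∘ suc) (P≡∅ ∘ suc)

exists-cong : ∀ {n} {P Q : Fin n → Bool} → (∀ j → P j ≡ Q j) → exists P ≡ exists Q
exists-cong {zero}  _   = refl
exists-cong {suc n} P≗Q = cong₂ _∨_ (P≗Q zero) (exists-cong (P≗Q ∘ suc))

size-⋃ : ∀ {m n} (I : Fin m → Bool) (F : Fin m → Fin n → Bool) r → (∀ w → size (F w) ≤ r) →
         size (λ j → exists (λ w → I w ∧ F w j)) ≤ size I * r
size-⋃ {zero}  {n} I F r _     = ≤-reflexive (size-∅ {n})
size-⋃ {suc m} {n} I F r ∣F∣≤r = begin
  size (λ j → (I zero ∧ F zero j) ∨ exists (λ w → I (suc w) ∧ F (suc w) j))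
    ≤⟨ size-∪ (λ j → I zero ∧ F zero j) _ ⟩
  size (λ j → I zero ∧ F zero j) + size (λ j → exists (λ w → I (suc w) ∧ F (suc w) j))
    ≤⟨ +-mono-≤ (guarded (I zero)) (size-⋃ (I ∘ suc) (F ∘ suc) r (∣F∣≤r ∘ suc)) ⟩
  bit (I zero) * r + size (I ∘ suc) * r
    ≡⟨ *-distribʳ-+ r (bit (I zero)) _ ⟨
  size I * r ∎
  where
  open ≤-Reasoning
  guarded : ∀ h → size (λ j → h ∧ F zero j) ≤ bit h * r
  guarded true  = subst (size (F zero) ≤_) (sym (+-identityʳ r)) (∣F∣≤r zero)
  guarded false = ≤-reflexive (size-∅ {n})

-- Counting colourings

Colouring : ℕ → Set
Colouring n = Fin n → Bool

-- count P is 2ⁿ times the probability of P under a uniformly random colouring.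
count : ∀ {n} → (Colouring n → Bool) → ℕ
count {zero}  P = bit (P λ ())
count {suc n} P = count (λ c → P (true ∷ c)) + count (λ c → P (false ∷ c))

count-cong : ∀ {n} {P Q : Colouring n → Bool} → (∀ c → P c ≡ Q c) → count P ≡ count Q
count-cong {zero}  P≗Q = cong bit (P≗Q _)
count-cong {suc n} P≗Q = cong₂ _+_ (count-cong (P≗Q ∘ (true ∷_))) (count-cong (P≗Q ∘ (false ∷_)))

count-mono : ∀ {n} {P Q : Colouring n → Bool} → P ⊆ Q → count P ≤ count Q
count-mono {zero}  P⊆Q = bit-mono (P⊆Q _)
count-mono {suc n} P⊆Q = +-mono-≤ (count-mono (P⊆Q ∘ (true ∷_))) (count-mono (P⊆Q ∘ (false ∷_)))

count-∪ : ∀ {n} (P Q : Colouring n → Bool) → count (P ∪ Q) ≤ count P + count Q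
count-∪ {zero}  P Q = bit-∨ (P _) (Q _)
count-∪ {suc n} P Q = begin
  count (Pᵗ ∪ Qᵗ) + count (Pᶠ ∪ Qᶠ)
    ≤⟨ +-mono-≤ (count-∪ Pᵗ Qᵗ) (count-∪ Pᶠ Qᶠ) ⟩
  (count Pᵗ + count Qᵗ) + (count Pᶠ + count Qᶠ)
    ≡⟨ [m+n]+[o+p]≡[m+o]+[n+p] (count Pᵗ) _ _ _ ⟩
  (count Pᵗ + count Pᶠ) + (count Qᵗ + count Qᶠ) ∎
  where
  open ≤-Reasoning
  Pᵗ Pᶠ Qᵗ Qᶠ : Colouring n → Bool
  Pᵗ c = P (true ∷ c)
  Pᶠ c = P (false ∷ c)
  Qᵗ c = Q (true ∷ c)
  Qᶠ c = Q (false ∷ c)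

count-split : ∀ {n} (P Q : Colouring n → Bool) → count P ≡ count (Q ∩ P) + count (∁ Q ∩ P)
count-split {zero}  P Q = bit-split (Q _) (P _)
count-split {suc n} P Q = trans
  (cong₂ _+_ (count-split (P ∘ (true ∷_)) (Q ∘ (true ∷_)))
             (count-split (P ∘ (false ∷_)) (Q ∘ (false ∷_))))
  ([m+n]+[o+p]≡[m+o]+[n+p] (count (λ c → Q (true ∷ c) ∧ P (true ∷ c))) _ _ _)

count-all : ∀ {n} → count {n} (λ _ → true) ≡ 2 ^ n
count-all {zero}  = refl
count-all {suc n} = cong₂ _+_ (count-all {n}) (trans (count-all {n}) (sym (+-identityʳ _)))

count-∅ : ∀ {n} (P : Colouring n → Bool) → (∀ c → P c ≡ false) → count P ≡ 0
count-∅ {zero}  P P≡∅ = cong bit (P≡∅ _)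
count-∅ {suc n} P P≡∅ =
  cong₂ _+_ (count-∅ (P ∘ (true ∷_)) (P≡∅ ∘ (true ∷_)))
            (count-∅ (P ∘ (false ∷_)) (P≡∅ ∘ (false ∷_)))

count>0 : ∀ {n} (P : Colouring n → Bool) → 0 < count P → Σ (Colouring n) (λ c → P c ≡ true)
count>0 {zero}  P #P>0 = (λ ()) , bit>0 #P>0
count>0 {suc n} P #P>0 with count (P ∘ (true ∷_)) in #Pᵗ
... | suc _ = let (c , Pc) = count>0 (P ∘ (true ∷_)) (subst (0 <_) (sym #Pᵗ) (s≤s z≤n)) in true ∷ c , Pc
... | zero  = let (c , Pc) = count>0 (P ∘ (false ∷_)) #P>0 in false ∷ c , Pc

DependsOn : ∀ {n} → (Fin n → Bool) → (Colouring n → Bool) → Set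
DependsOn I P = ∀ c c′ → (∀ j → I j ≡ true → c j ≡ c′ j) → P c ≡ P c′

DependsOn-tail : ∀ {n} {I : Fin (suc n) → Bool} {P} → DependsOn I P →
                 ∀ x → DependsOn (I ∘ suc) (P ∘ (x ∷_))
DependsOn-tail dP x c c′ agree = dP (x ∷ c) (x ∷ c′) λ where
  zero    _  → refl
  (suc j) Ij → agree j Ij

DependsOn-head-free : ∀ {n} {I : Fin (suc n) → Bool} {P} → DependsOn I P → I zero ≡ false →
                      ∀ c → P (true ∷ c) ≡ P (false ∷ c)
DependsOn-head-free dP I₀ c = dP (true ∷ c) (false ∷ c) λ where
  zero    I₀′ → contradiction (trans (sym I₀) I₀′) λ ()
  (suc j) _   → refl

DependsOn-∁∁ : ∀ {n} {I : Fin n → Bool} {P} → DependsOn I P → DependsOn (∁ (∁ I)) P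
DependsOn-∁∁ {I = I} dP c c′ agree = dP c c′ λ j Ij → agree j (trans (not-involutive (I j)) Ij)

private
  halves-product : ∀ a b e x z w → a * e ≡ x * z → b * e ≡ x * w → (a + b) * (2 * e) ≡ (x + x) * (z + w)
  halves-product a b e x z w ae≡xz be≡xw = begin
    (a + b) * (2 * e)                  ≡⟨ expandˡ a b e ⟩
    (a * e + b * e) + (a * e + b * e)  ≡⟨ cong₂ (λ u v → (u + v) + (u + v)) ae≡xz be≡xw ⟩
    (x * z + x * w) + (x * z + x * w)  ≡⟨ expandʳ x z w ⟨
    (x + x) * (z + w)                  ∎
    where
    open ≡-Reasoning
    expandˡ : ∀ a b e → (a + b) * (2 * e) ≡ (a * e + b * e) + (a * e + b * e)
    expandˡ = solve-∀
    expandʳ : ∀ x z w → (x + x) * (z + w) ≡ (x * z + x * w) + (x * z + x * w)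
    expandʳ = solve-∀

count-independent : ∀ {n} (I : Fin n → Bool) {P Q : Colouring n → Bool} →
                    DependsOn I P → DependsOn (∁ I) Q → count (P ∩ Q) * 2 ^ n ≡ count P * count Q
count-independent {zero}  I {P} {Q} _ _ = trans (*-identityʳ _) (bit-∧ (P _) (Q _))
count-independent {suc n} I {P} {Q} dP dQ = by-head (I zero) refl
  where
  head-free-left : ∀ (I : Fin (suc n) → Bool) {P Q} → I zero ≡ false →
                   DependsOn I P → DependsOn (∁ I) Q →
                   count (P ∩ Q) * 2 ^ suc n ≡ count P * count Q
  head-free-left I {P} {Q} I₀ dP dQ = trans
    (halves-product (count ((P ∩ Q) ∘ (true ∷_))) (count ((P ∩ Q) ∘ (false ∷_))) (2 ^ n)
                    (count (P ∘ (true ∷_))) _ _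
      (count-independent (I ∘ suc) (DependsOn-tail dP true) (DependsOn-tail dQ true))
      (trans (count-independent (I ∘ suc) (DependsOn-tail dP false) (DependsOn-tail dQ false))
             (cong (_* count (Q ∘ (false ∷_))) Pᶠ≡Pᵗ)))
    (cong (λ u → (count (P ∘ (true ∷_)) + u) * count Q) (sym Pᶠ≡Pᵗ))
    where
    Pᶠ≡Pᵗ : count (P ∘ (false ∷_)) ≡ count (P ∘ (true ∷_))
    Pᶠ≡Pᵗ = sym (count-cong (DependsOn-head-free dP I₀))

  by-head : ∀ h → I zero ≡ h → count (P ∩ Q) * 2 ^ suc n ≡ count P * count Q
  by-head false I₀ = head-free-left I I₀ dP dQ
  by-head true  I₀ = begin
    count (P ∩ Q) * 2 ^ suc n  ≡⟨ cong (_* 2 ^ suc n) (count-cong λ c → ∧-comm (P c) (Q c)) ⟩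
    count (Q ∩ P) * 2 ^ suc n  ≡⟨ head-free-left (∁ I) (cong not I₀) dQ (DependsOn-∁∁ dP) ⟩
    count Q * count P          ≡⟨ *-comm (count Q) (count P) ⟩
    count P * count Q          ∎
    where open ≡-Reasoning

-- The local lemma

meets : ∀ {n} → (Fin n → Bool) → (Fin n → Bool) → Bool
meets A B = exists (A ∩ B)

meets≡false : ∀ {n} (A : Fin n → Bool) {B} → meets A B ≡ false → ∀ w → B w ≡ true → A w ≡ false
meets≡false A {B} A∩B≡∅ w Bw = trans (sym (∧-identityʳ (A w)))
  (subst (λ b → A w ∧ b ≡ false) Bw (exists-false⁻ (A ∩ B) A∩B≡∅ w))

module LocalLemma {m n : ℕ} (E : Fin m → Colouring n → Bool) (supp : Fin m → Fin n → Bool)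
  (E-local : ∀ i → DependsOn (supp i) (E i))
  (D : ℕ) {{D≢0 : NonZero D}}
  (E-rare : ∀ i → 4 * D * count (E i) ≤ 2 ^ n)
  (few-overlaps : ∀ i → size (λ j → meets (supp i) (supp j)) ≤ D)
  where

  avoids : (Fin m → Bool) → Colouring n → Bool
  avoids S c = not (exists λ j → S j ∧ E j c)

  avoids-elim : ∀ {S c} → avoids S c ≡ true → ∀ j → S j ≡ true → E j c ≡ false
  avoids-elim {S} {c} ok j Sj =
    subst (λ s → s ∧ E j c ≡ false) Sj (exists-false⁻ (λ j → S j ∧ E j c) (not≡true ok) j)

  avoids-intro : ∀ {S c} → (∀ j → S j ≡ true → E j c ≡ false) → avoids S c ≡ true
  avoids-intro {S} {c} none = cong not (exists-false⁺ (λ j → S j ∧ E j c) absent)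
    where
    absent : ∀ j → S j ∧ E j c ≡ false
    absent j with S j in Sj
    ... | true  = none j Sj
    ... | false = refl

  avoids-antitone : ∀ {S T} → T ⊆ S → avoids S ⊆ avoids T
  avoids-antitone T⊆S c ok = avoids-intro λ j Tj → avoids-elim ok j (T⊆S j Tj)

  avoids-local : ∀ i B → (∀ j → B j ≡ true → meets (supp i) (supp j) ≡ false) →
                 DependsOn (∁ (supp i)) (avoids B)
  avoids-local i B apart c c′ agree = cong not (exists-cong λ j → ∧-cong-guarded (B j) λ Bj →
    E-local j c c′ λ w suppʲw → agree w (cong not (meets≡false (supp i) (apart j Bj) w suppʲw)))

  peel-one : ∀ T U j → (∀ x → U x ≡ true → T x ≡ true ⊎ x ≡ j) →
             count (avoids T) ≤ count (E j ∩ avoids T) + count (avoids U)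
  peel-one T U j U⊆T+j = begin
    count (avoids T)                                   ≡⟨ count-split (avoids T) (E j) ⟩
    count (E j ∩ avoids T) + count (∁ (E j) ∩ avoids T) ≤⟨ +-monoʳ-≤ _ (count-mono survivors) ⟩
    count (E j ∩ avoids T) + count (avoids U)           ∎
    where
    open ≤-Reasoning
    survivors : ∁ (E j) ∩ avoids T ⊆ avoids U
    survivors c ok = avoids-intro λ x Ux → case U⊆T+j x Ux of λ where
      (inj₁ Tx)   → avoids-elim (∩-⊆ʳ (∁ (E j)) (avoids T) c ok) x Tx
      (inj₂ refl) → not≡true (∩-⊆ˡ (∁ (E j)) (avoids T) c ok)

  RareGiven : (Fin m → Bool) → Set
  RareGiven S = ∀ i → 2 * D * count (E i ∩ avoids S) ≤ count (avoids S)

  private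
    peel-arith : ∀ {d z t e a k} → d * z ≤ d * t + k * z → t ≤ e + a → d * e ≤ z →
                 d * z ≤ d * a + suc k * z
    peel-arith {d} {z} {t} {e} {a} {k} dz≤dt+kz t≤e+a de≤z = begin
      d * z                  ≤⟨ dz≤dt+kz ⟩
      d * t + k * z          ≤⟨ +-monoˡ-≤ (k * z) (*-monoʳ-≤ d t≤e+a) ⟩
      d * (e + a) + k * z    ≡⟨ cong (_+ k * z) (*-distribˡ-+ d e a) ⟩
      d * e + d * a + k * z  ≤⟨ +-monoˡ-≤ (k * z) (+-monoˡ-≤ (d * a) de≤z) ⟩
      z + d * a + k * z      ≡⟨ rearrange z (d * a) (k * z) ⟩
      d * a + (z + k * z)    ∎
      where
      open ≤-Reasoning
      rearrange : ∀ z x y → z + x + y ≡ x + (z + y)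
      rearrange = solve-∀

    halving : ∀ {z s} → 2 * D * z ≤ 2 * D * s + D * z → z ≤ 2 * s
    halving {z} {s} 2Dz≤2Ds+Dz = *-cancelˡ-≤ D (+-cancelʳ-≤ (D * z) (D * z) (D * (2 * s)) (begin
      D * z + D * z        ≡⟨ double D z ⟨
      2 * D * z            ≤⟨ 2Dz≤2Ds+Dz ⟩
      2 * D * s + D * z    ≡⟨ cong (_+ D * z) (regroup D s) ⟩
      D * (2 * s) + D * z  ∎))
      where
      open ≤-Reasoning
      double : ∀ D z → 2 * D * z ≡ D * z + D * z
      double = solve-∀
      regroup : ∀ D s → 2 * D * s ≡ D * (2 * s)
      regroup = solve-∀

    remainder-positive : ∀ {t e a} → 0 < t → t ≤ e + a → 2 * D * e ≤ t → 0 < a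
    remainder-positive {a = suc a} _ _ _ = s≤s z≤n
    remainder-positive {t} {e} {zero} 0<t t≤e+0 2De≤t =
      contradiction (≤-trans 2De≤t t≤e) (<⇒≱ e<2De)
      where
      t≤e : t ≤ e
      t≤e = subst (t ≤_) (+-identityʳ e) t≤e+0
      instance _ = >-nonZero (<-≤-trans 0<t t≤e)
      e<2De : e < 2 * D * e
      e<2De = subst (e <_) (*-comm e (2 * D)) (m<m*n e (2 * D) (*-monoʳ-≤ 2 (>-nonZero⁻¹ D)))

  -- Adding the elements of X to B one at a time, each costs at most count (avoids B) / 2D:
  -- apply peel-one and the hypothesis on the proper subsets of S.
  peel : ∀ S → (∀ {T} → size T < size S → RareGiven T) → ∀ B → B ⊆ S →
         ∀ k X → size X ≡ k → X ⊆ S → X ⊆ ∁ B →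
         2 * D * count (avoids B) ≤ 2 * D * count (avoids (B ∪ X)) + k * count (avoids B)
  peel S rare-below B B⊆S zero X ∣X∣≡0 _ _ =
    ≤-trans (*-monoʳ-≤ (2 * D) (count-mono (avoids-antitone (∪-⊆ (λ _ Bx → Bx) X⊆B))))
            (m≤m+n _ _)
    where
    X⊆B : X ⊆ B
    X⊆B x Xx = contradiction (trans (sym Xx) (size≡0 X ∣X∣≡0 x)) λ ()
  peel S rare-below B B⊆S (suc k) X ∣X∣≡1+k X⊆S X⊆∁B =
    peel-arith {d = 2 * D} {k = k}
      (peel S rare-below B B⊆S k X′ ∣X′∣≡k
            (λ x → X⊆S x ∘ ─-⊆ X j x) (λ x → X⊆∁B x ∘ ─-⊆ X j x))
      (peel-one T (B ∪ X) j cover)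
      (≤-trans (rare-below (size-< j T⊆S Tj≡false (X⊆S j Xj)) j)
               (count-mono (avoids-antitone (⊆-∪ˡ B X′))))
    where
    jXj : Σ (Fin m) (λ j → X j ≡ true)
    jXj = size>0 X (subst (0 <_) (sym ∣X∣≡1+k) (s≤s z≤n))
    j : Fin m
    j = proj₁ jXj
    Xj : X j ≡ true
    Xj = proj₂ jXj
    X′ T : Fin m → Bool
    X′ = X ─ j
    T = B ∪ X′
    ∣X′∣≡k : size X′ ≡ k
    ∣X′∣≡k = suc-injective (trans (size-─ X j Xj) ∣X∣≡1+k)
    T⊆S : T ⊆ S
    T⊆S = ∪-⊆ B⊆S (λ x → X⊆S x ∘ ─-⊆ X j x)
    Tj≡false : T j ≡ false
    Tj≡false rewrite not≡true (X⊆∁B j Xj) = ─-self X j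
    cover : ∀ x → (B ∪ X) x ≡ true → T x ≡ true ⊎ x ≡ j
    cover x BXx with B x
    ... | true  = inj₁ refl
    ... | false with ─-cover X j x BXx
    ...   | inj₁ X′x = inj₁ X′x
    ...   | inj₂ x≡j = inj₂ x≡j

  -- E i is independent of avoiding the events B that share no coordinate with it, and
  -- avoiding the remaining at most D events of S costs at most half of the colourings.
  rare-step : ∀ S → (∀ {T} → size T < size S → RareGiven T) → RareGiven S
  rare-step S rare-below i = *-cancelˡ-≤ 2 (begin
    2 * (2 * D * count (E i ∩ avoids S))  ≤⟨ *-monoʳ-≤ 2 (*-monoʳ-≤ (2 * D) (count-mono
                                               (∩-monoʳ (E i) (avoids-antitone (∩-⊆ˡ S (∁ O)))))) ⟩
    2 * (2 * D * count (E i ∩ avoids B))  ≡⟨ doubling D (count (E i ∩ avoids B)) ⟩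
    4 * D * count (E i ∩ avoids B)        ≤⟨ rare-given-B ⟩
    count (avoids B)                      ≤⟨ halving (≤-trans peeled (+-mono-≤ S-covered X-small)) ⟩
    2 * count (avoids S)                  ∎)
    where
    open ≤-Reasoning
    O B X : Fin m → Bool
    O j = meets (supp i) (supp j)
    B = S ∩ ∁ O
    X = S ∩ O

    doubling : ∀ D y → 2 * (2 * D * y) ≡ 4 * D * y
    doubling = solve-∀

    rare-given-B : 4 * D * count (E i ∩ avoids B) ≤ count (avoids B)
    rare-given-B = *-cancelʳ-≤ _ _ (2 ^ n) {{m^n≢0 2 n}} (begin
      4 * D * count (E i ∩ avoids B) * 2 ^ n    ≡⟨ *-assoc (4 * D) _ (2 ^ n) ⟩
      4 * D * (count (E i ∩ avoids B) * 2 ^ n)  ≡⟨ cong (4 * D *_) independent ⟩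
      4 * D * (count (E i) * count (avoids B))  ≡⟨ *-assoc (4 * D) _ _ ⟨
      4 * D * count (E i) * count (avoids B)    ≤⟨ *-monoˡ-≤ _ (E-rare i) ⟩
      2 ^ n * count (avoids B)                  ≡⟨ *-comm (2 ^ n) _ ⟩
      count (avoids B) * 2 ^ n                  ∎)
      where
      independent : count (E i ∩ avoids B) * 2 ^ n ≡ count (E i) * count (avoids B)
      independent = count-independent (supp i) (E-local i)
        (avoids-local i B λ j Bj → not≡true (∩-⊆ʳ S (∁ O) j Bj))

    peeled : 2 * D * count (avoids B) ≤ 2 * D * count (avoids (B ∪ X)) + size X * count (avoids B)
    peeled = peel S rare-below B (∩-⊆ˡ S (∁ O)) (size X) X refl (∩-⊆ˡ S O) (∩-⊆-∁∩∁ S O)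

    S-covered : 2 * D * count (avoids (B ∪ X)) ≤ 2 * D * count (avoids S)
    S-covered = *-monoʳ-≤ (2 * D) (count-mono (avoids-antitone (⊆-∩∁∪∩ S O)))

    X-small : size X * count (avoids B) ≤ D * count (avoids B)
    X-small = *-monoˡ-≤ _ (≤-trans (size-mono (∩-⊆ʳ S O)) (few-overlaps i))

  rare-given : ∀ S → RareGiven S
  rare-given = size-induction RareGiven rare-step

  avoidable-step : ∀ S → (∀ {T} → size T < size S → 0 < count (avoids T)) → 0 < count (avoids S)
  avoidable-step S avoidable-below with size S in ∣S∣
  ... | zero  = begin-strict
    0                      <⟨ m^n>0 2 n ⟩
    2 ^ n                  ≡⟨ count-all {n} ⟨
    count {n} (λ _ → true) ≤⟨ count-mono everything-avoids ⟩
    count (avoids S)       ∎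
    where
    open ≤-Reasoning
    everything-avoids : (λ _ → true) ⊆ avoids S
    everything-avoids c _ = avoids-intro λ j Sj → contradiction (trans (sym Sj) (size≡0 S ∣S∣ j)) λ ()
  ... | suc k =
    remainder-positive (avoidable-below ∣S′∣<∣S∣) (peel-one S′ S j (─-cover S j)) (rare-given S′ j)
    where
    jSj : Σ (Fin m) (λ j → S j ≡ true)
    jSj = size>0 S (subst (0 <_) (sym ∣S∣) (s≤s z≤n))
    j : Fin m
    j = proj₁ jSj
    S′ : Fin m → Bool
    S′ = S ─ j
    ∣S′∣<∣S∣ : size S′ < suc k
    ∣S′∣<∣S∣ = ≤-reflexive (trans (size-─ S j (proj₂ jSj)) ∣S∣)

  avoidable : ∀ S → 0 < count (avoids S)
  avoidable = size-induction (λ S → 0 < count (avoids S)) avoidable-step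

  avoiding-colouring : Σ (Colouring n) (λ c → ∀ i → E i c ≡ false)
  avoiding-colouring =
    let (c , ok) = count>0 (avoids (λ _ → true)) (avoidable (λ _ → true))
    in  c , λ i → avoids-elim ok i refl

-- A Chernoff bound

<ᵇ≡false⇒≥ : ∀ {m n} → (m <ᵇ n) ≡ false → n ≤ m
<ᵇ≡false⇒≥ {m} {n} m≮n = ≮⇒≥ λ m<n → subst IsTrue m≮n (<⇒<ᵇ m<n)

≥⇒<ᵇ≡false : ∀ {m n} → n ≤ m → (m <ᵇ n) ≡ false
≥⇒<ᵇ≡false {m} {n} n≤m with m <ᵇ n in m<ᵇn
... | false = refl
... | true  = contradiction (<ᵇ⇒< m n (subst IsTrue (sym m<ᵇn) _)) (≤⇒≯ n≤m)

+-<ᵇ : ∀ k m n → (k + m <ᵇ k + n) ≡ (m <ᵇ n)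
+-<ᵇ zero    m n = refl
+-<ᵇ (suc k) m n = +-<ᵇ k m n

ofColour : ∀ {n} → Bool → Colouring n → Fin n → Bool
ofColour b c j = if b then c j else not (c j)

deficient : ∀ {n} → ℕ → (Fin n → Bool) → Bool → ℕ → Colouring n → Bool
deficient k I b M c = size (I ∩ ofColour b c) * k <ᵇ M

weight : ∀ {n} → ℕ → (Fin n → Bool) → ℕ
weight {zero}  W I = 1
weight {suc n} W I = (if I zero then W else 2) * weight W (I ∘ suc)

weight-size : ∀ {n} W (I : Fin n → Bool) → weight W I * 2 ^ size I ≡ 2 ^ n * W ^ size I
weight-size {zero}  W I = refl
weight-size {suc n} W I = step (I zero) (weight-size W (I ∘ suc))
  where
  S = weight W (I ∘ suc)
  m = size (I ∘ suc)
  step : ∀ h → S * 2 ^ m ≡ 2 ^ n * W ^ m →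
         (if h then W else 2) * S * 2 ^ (bit h + m) ≡ 2 ^ suc n * W ^ (bit h + m)
  step true  S2ᵐ≡2ⁿWᵐ = begin
    W * S * (2 * 2 ^ m)      ≡⟨ regroupˡ W S (2 ^ m) ⟩
    2 * W * (S * 2 ^ m)      ≡⟨ cong (2 * W *_) S2ᵐ≡2ⁿWᵐ ⟩
    2 * W * (2 ^ n * W ^ m)  ≡⟨ regroupʳ W (2 ^ n) (W ^ m) ⟩
    2 * 2 ^ n * (W * W ^ m)  ∎
    where
    open ≡-Reasoning
    regroupˡ : ∀ W S a → W * S * (2 * a) ≡ 2 * W * (S * a)
    regroupˡ = solve-∀
    regroupʳ : ∀ W a b → 2 * W * (a * b) ≡ 2 * a * (W * b)
    regroupʳ = solve-∀
  step false S2ᵐ≡2ⁿWᵐ = begin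
    2 * S * 2 ^ m        ≡⟨ *-assoc 2 S (2 ^ m) ⟩
    2 * (S * 2 ^ m)      ≡⟨ cong (2 *_) S2ᵐ≡2ⁿWᵐ ⟩
    2 * (2 ^ n * W ^ m)  ≡⟨ *-assoc 2 (2 ^ n) (W ^ m) ⟨
    2 * 2 ^ n * W ^ m    ∎
    where open ≡-Reasoning

module Chernoff (p q k : ℕ) (q≤p : q ≤ p) where

  pᵏ qᵏ W : ℕ
  pᵏ = p ^ k
  qᵏ = q ^ k
  W = pᵏ + qᵏ

  -- Cleared of denominators, Pr[k X < M] ≤ (p/q)^M ∏ⱼ∈I (pᵏ + qᵏ)/(2pᵏ) for X the number of
  -- coordinates in I of colour b: Markov's inequality for (q/p)^(k X), a product over I.
  Bound : ∀ {n} → (Fin n → Bool) → Bool → ℕ → Set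
  Bound I b M = count (deficient k I b M) * (q ^ M * pᵏ ^ size I) ≤ p ^ M * weight W I

  private
    sum-bound : ∀ {a b K} x u v Y → a * K ≤ x * (u * Y) → b * K ≤ x * (v * Y) →
                (a + b) * K ≤ x * ((u + v) * Y)
    sum-bound {a} {b} {K} x u v Y aK≤ bK≤ = begin
      (a + b) * K               ≡⟨ *-distribʳ-+ K a b ⟩
      a * K + b * K             ≤⟨ +-mono-≤ aK≤ bK≤ ⟩
      x * (u * Y) + x * (v * Y) ≡⟨ collect x u v Y ⟩
      x * ((u + v) * Y)         ∎
      where
      open ≤-Reasoning
      collect : ∀ x u v Y → x * (u * Y) + x * (v * Y) ≡ x * ((u + v) * Y)
      collect = solve-∀

  Bound-pᵏ : ∀ {n} (I : Fin n → Bool) b M → Bound I b M →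
             count (deficient k I b M) * (q ^ M * (pᵏ * pᵏ ^ size I)) ≤ p ^ M * (pᵏ * weight W I)
  Bound-pᵏ I b M bound = begin
    a * (q ^ M * (pᵏ * pᵏ ^ size I))  ≡⟨ pull-out a (q ^ M) pᵏ (pᵏ ^ size I) ⟩
    a * (q ^ M * pᵏ ^ size I) * pᵏ    ≤⟨ *-monoˡ-≤ pᵏ bound ⟩
    p ^ M * weight W I * pᵏ           ≡⟨ push-in (p ^ M) (weight W I) pᵏ ⟩
    p ^ M * (pᵏ * weight W I)         ∎
    where
    open ≤-Reasoning
    a = count (deficient k I b M)
    pull-out : ∀ a x e X → a * (x * (e * X)) ≡ a * (x * X) * e
    pull-out = solve-∀
    push-in : ∀ y Y e → y * Y * e ≡ y * (e * Y)
    push-in = solve-∀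

  shifted : ∀ {n} (f : Colouring n → ℕ) X Y →
            (∀ M → count (λ c → f c <ᵇ M) * (q ^ M * X) ≤ p ^ M * Y) →
            ∀ M → count (λ c → k + f c <ᵇ M) * (q ^ M * (pᵏ * X)) ≤ p ^ M * (qᵏ * Y)
  shifted f X Y bound M with k ≤? M
  ... | no  k≰M = ≤-trans (≤-reflexive (cong (_* (q ^ M * (pᵏ * X))) (count-∅ _ never))) z≤n
    where
    never : ∀ c → (k + f c <ᵇ M) ≡ false
    never c = ≥⇒<ᵇ≡false (≤-trans (<⇒≤ (≰⇒> k≰M)) (m≤m+n k (f c)))
  ... | yes k≤M with ≤⇒≤″ k≤M
  ...   | M′ , refl = begin
    count (λ c → k + f c <ᵇ k + M′) * (q ^ (k + M′) * (pᵏ * X))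
      ≡⟨ cong (_* (q ^ (k + M′) * (pᵏ * X))) (count-cong λ c → +-<ᵇ k (f c) M′) ⟩
    Y′ * (q ^ (k + M′) * (pᵏ * X))
      ≡⟨ cong (λ t → Y′ * (t * (pᵏ * X))) (^-distribˡ-+-* q k M′) ⟩
    Y′ * (qᵏ * q ^ M′ * (pᵏ * X))
      ≡⟨ regroupˡ Y′ qᵏ (q ^ M′) pᵏ X ⟩
    Y′ * (q ^ M′ * X) * (qᵏ * pᵏ)
      ≤⟨ *-monoˡ-≤ (qᵏ * pᵏ) (bound M′) ⟩
    p ^ M′ * Y * (qᵏ * pᵏ)
      ≡⟨ regroupʳ (p ^ M′) Y qᵏ pᵏ ⟩
    pᵏ * p ^ M′ * (qᵏ * Y)
      ≡⟨ cong (_* (qᵏ * Y)) (^-distribˡ-+-* p k M′) ⟨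
    p ^ (k + M′) * (qᵏ * Y) ∎
    where
    open ≤-Reasoning
    Y′ = count (λ c → f c <ᵇ M′)
    regroupˡ : ∀ a b c d e → a * (b * c * (d * e)) ≡ a * (c * e) * (b * d)
    regroupˡ = solve-∀
    regroupʳ : ∀ a b c d → a * b * (c * d) ≡ d * a * (c * b)
    regroupʳ = solve-∀

  cons-bound : ∀ {n} h (I : Fin n → Bool) b M → (∀ M′ → Bound I b M′) → Bound (h ∷ I) b M
  cons-bound false I b M bound = begin
    (Y + Y) * K        ≡⟨ *-distribʳ-+ K Y Y ⟩
    Y * K + Y * K      ≤⟨ +-mono-≤ (bound M) (bound M) ⟩
    R + R              ≡⟨ cong (R +_) (+-identityʳ R) ⟨
    2 * R              ≡⟨ m*[n*o]≡n*[m*o] 2 (p ^ M) (weight W I) ⟩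
    p ^ M * (2 * weight W I) ∎
    where
    open ≤-Reasoning
    Y = count (deficient k I b M)
    K = q ^ M * pᵏ ^ size I
    R = p ^ M * weight W I
  cons-bound true I true  M bound = ≤-trans
    (sum-bound {a = headInClass} {count (deficient k I true M)} {K} (p ^ M) qᵏ pᵏ (weight W I)
      (shifted (λ c → size (I ∩ ofColour true c) * k) (pᵏ ^ size I) (weight W I) bound M)
      (Bound-pᵏ I true M (bound M)))
    (≤-reflexive (cong (λ u → p ^ M * (u * weight W I)) (+-comm qᵏ pᵏ)))
    where
    headInClass K : ℕ
    headInClass = count (λ c → k + size (I ∩ ofColour true c) * k <ᵇ M)
    K = q ^ M * (pᵏ * pᵏ ^ size I)
  cons-bound true I false M bound =
    sum-bound {a = count (deficient k I false M)} {headInClass} {K} (p ^ M) pᵏ qᵏ (weight W I)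
      (Bound-pᵏ I false M (bound M))
      (shifted (λ c → size (I ∩ ofColour false c) * k) (pᵏ ^ size I) (weight W I) bound M)
    where
    headInClass K : ℕ
    headInClass = count (λ c → k + size (I ∩ ofColour false c) * k <ᵇ M)
    K = q ^ M * (pᵏ * pᵏ ^ size I)

  chernoff-weighted : ∀ {n} (I : Fin n → Bool) b M → Bound I b M
  chernoff-weighted {zero}  I b M = begin
    bit (0 <ᵇ M) * (q ^ M * 1) ≤⟨ *-monoˡ-≤ (q ^ M * 1) (bit≤1 (0 <ᵇ M)) ⟩
    1 * (q ^ M * 1)            ≡⟨ *-identityˡ (q ^ M * 1) ⟩
    q ^ M * 1                  ≤⟨ *-monoˡ-≤ 1 (^-monoˡ-≤ M q≤p) ⟩
    p ^ M * 1                  ∎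
    where open ≤-Reasoning
  chernoff-weighted {suc n} I b M = cons-bound (I zero) (I ∘ suc) b M (chernoff-weighted (I ∘ suc) b)

  chernoff : ∀ {n} (I : Fin n → Bool) b M →
             count (deficient k I b M) * (q ^ M * pᵏ ^ size I * 2 ^ size I) ≤ 2 ^ n * (p ^ M * W ^ size I)
  chernoff {n} I b M = begin
    X * (q ^ M * pᵏ ^ size I * 2 ^ size I)  ≡⟨ *-assoc X (q ^ M * pᵏ ^ size I) (2 ^ size I) ⟨
    X * (q ^ M * pᵏ ^ size I) * 2 ^ size I  ≤⟨ *-monoˡ-≤ (2 ^ size I) (chernoff-weighted I b M) ⟩
    p ^ M * weight W I * 2 ^ size I        ≡⟨ *-assoc (p ^ M) (weight W I) (2 ^ size I) ⟩
    p ^ M * (weight W I * 2 ^ size I)      ≡⟨ cong (p ^ M *_) (weight-size W I) ⟩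
    p ^ M * (2 ^ n * W ^ size I)           ≡⟨ m*[n*o]≡n*[m*o] (p ^ M) (2 ^ n) (W ^ size I) ⟩
    2 ^ n * (p ^ M * W ^ size I)           ∎
    where
    open ≤-Reasoning
    X = count (deficient k I b M)

-- Numerical estimates

power-dominates-square : ∀ a α β → a * (28 * 28) * α ^ 28 ≤ β ^ 28 → 31 * α ≤ 28 * β →
                         ∀ r → 28 ≤ r → a * (r * r) * α ^ r ≤ β ^ r
power-dominates-square a α β base ratio r 28≤r =
  subst (λ r → a * (r * r) * α ^ r ≤ β ^ r) (m+[n∸m]≡n 28≤r) (from-28 (r ∸ 28))
  where
  square-ratio : ∀ k → 28 * ((29 + k) * (29 + k)) ≤ 31 * ((28 + k) * (28 + k))
  square-ratio k = subst (28 * ((29 + k) * (29 + k)) ≤_) (expand k) (m≤m+n _ _)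
    where
    expand : ∀ k → 28 * ((29 + k) * (29 + k)) + (756 + 112 * k + 3 * (k * k)) ≡
                   31 * ((28 + k) * (28 + k))
    expand = solve-∀

  from-28 : ∀ k → a * ((28 + k) * (28 + k)) * α ^ (28 + k) ≤ β ^ (28 + k)
  from-28 zero    = base
  from-28 (suc k) = *-cancelˡ-≤ 28 (begin
    28 * (a * (s * s) * α ^ suc t)  ≡⟨ regroupˡ a (s * s) α (α ^ t) ⟩
    a * (28 * (s * s)) * (α ^ t * α) ≤⟨ *-monoˡ-≤ (α ^ t * α) (*-monoʳ-≤ a (square-ratio k)) ⟩
    a * (31 * (t * t)) * (α ^ t * α) ≡⟨ regroupʳ a (t * t) (α ^ t) α ⟩
    a * (t * t) * α ^ t * (31 * α)   ≤⟨ *-mono-≤ (from-28 k) ratio ⟩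
    β ^ t * (28 * β)                 ≡⟨ regroup (β ^ t) β ⟩
    28 * (β * β ^ t)                 ∎)
    where
    open ≤-Reasoning
    t = 28 + k
    s = suc t
    regroupˡ : ∀ a x α y → 28 * (a * x * (α * y)) ≡ a * (28 * x) * (y * α)
    regroupˡ = solve-∀
    regroupʳ : ∀ a x y α → a * (31 * x) * (y * α) ≡ a * x * y * (31 * α)
    regroupʳ = solve-∀
    regroup : ∀ x y → x * (28 * y) ≡ 28 * (y * x)
    regroup = solve-∀

*-cancel-ratio : ∀ {x y a b} c .{{_ : NonZero b}} → x * b ≤ y * a → c * a ≤ b → c * x ≤ y
*-cancel-ratio {x} {y} {a} {b} c xb≤ya ca≤b = *-cancelʳ-≤ (c * x) y b (begin
  c * x * b    ≡⟨ *-assoc c x b ⟩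
  c * (x * b)  ≤⟨ *-monoʳ-≤ c xb≤ya ⟩
  c * (y * a)  ≡⟨ m*[n*o]≡n*[m*o] c y a ⟩
  y * (c * a)  ≤⟨ *-monoʳ-≤ y ca≤b ⟩
  y * b        ∎)
  where open ≤-Reasoning

^-distribʳ-* : ∀ x y r → (x * y) ^ r ≡ x ^ r * y ^ r
^-distribʳ-* x y zero    = refl
^-distribʳ-* x y (suc r) =
  trans (cong (x * y *_) (^-distribʳ-* x y r)) ([m*n]*[o*p]≡[m*o]*[n*p] x y (x ^ r) (y ^ r))

-- Balanced partitions of regular graphs

module Balanced {n r} (G : SimpleGraph n) (regular : Regular G r) where

  open Chernoff 50 49 100 (n≤1+n 49)

  -- Chernoff's bound at M = 11 r reads Pr[deficientAt v b] ≤ (α/β)^r.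
  α β : ℕ
  α = 50 ^ 11 * W
  β = 49 ^ 11 * pᵏ * 2

  size-adj : ∀ v → size (adj G v) ≡ r
  size-adj v = trans (sym (countWhere≡size (adj G v))) (regular v)

  deficientAt : Fin n → Bool → Colouring n → Bool
  deficientAt v b = deficient 100 (adj G v) b (11 * r)

  lopsided : Fin n → Colouring n → Bool
  lopsided v c = deficientAt v true c ∨ deficientAt v false c

  lopsided-local : ∀ v → DependsOn (adj G v) (lopsided v)
  lopsided-local v c c′ agree = cong₂ _∨_ (same-deficiency true) (same-deficiency false)
    where
    same-deficiency : ∀ b → deficientAt v b c ≡ deficientAt v b c′
    same-deficiency b = cong (λ s → s * 100 <ᵇ 11 * r) (size-cong λ j →
      ∧-cong-guarded (adj G v j) λ adjvj → cong (λ x → if b then x else not x) (agree j adjvj))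

  balanced : ∀ {v c} b → deficientAt v b c ≡ false → 11 * r ≤ 100 * neighboursIn G (ofColour b c) v
  balanced {v} {c} b not-deficient = subst (11 * r ≤_)
    (trans (*-comm (size U) 100) (cong (100 *_) (sym (countWhere≡size U))))
    (<ᵇ≡false⇒≥ not-deficient)
    where
    U : Fin n → Bool
    U = adj G v ∩ ofColour b c

  common-neighbours : ∀ v → size (λ u → meets (adj G v) (adj G u)) ≤ r * r
  common-neighbours v = subst (λ s → size (λ u → meets (adj G v) (adj G u)) ≤ s * r) (size-adj v)
    (size-⋃ (adj G v) (λ w u → adj G u w) r λ w →
      ≤-reflexive (trans (size-cong λ u → symmetric G u w) (size-adj w)))

  one-side-rare : 28 ≤ r → ∀ v b → 8 * (r * r) * count (deficientAt v b) ≤ 2 ^ n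
  one-side-rare 28≤r v b = *-cancel-ratio {b = β ^ r} (8 * (r * r)) {{m^n≢0 β r}} tail-bound
    (power-dominates-square 8 α β (≤ᵇ⇒≤ _ _ _) (≤ᵇ⇒≤ _ _ _) r 28≤r)
    where
    βʳ : β ^ r ≡ 49 ^ (11 * r) * pᵏ ^ r * 2 ^ r
    βʳ = begin
      (49 ^ 11 * pᵏ * 2) ^ r             ≡⟨ ^-distribʳ-* (49 ^ 11 * pᵏ) 2 r ⟩
      (49 ^ 11 * pᵏ) ^ r * 2 ^ r         ≡⟨ cong (_* 2 ^ r) (^-distribʳ-* (49 ^ 11) pᵏ r) ⟩
      (49 ^ 11) ^ r * pᵏ ^ r * 2 ^ r     ≡⟨ cong (λ x → x * pᵏ ^ r * 2 ^ r) (^-*-assoc 49 11 r) ⟩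
      49 ^ (11 * r) * pᵏ ^ r * 2 ^ r     ∎
      where open ≡-Reasoning
    αʳ : α ^ r ≡ 50 ^ (11 * r) * W ^ r
    αʳ = trans (^-distribʳ-* (50 ^ 11) W r) (cong (_* W ^ r) (^-*-assoc 50 11 r))
    tail-bound : count (deficientAt v b) * β ^ r ≤ 2 ^ n * α ^ r
    tail-bound = subst₂ (λ B A → count (deficientAt v b) * B ≤ 2 ^ n * A)
      (trans (cong (λ s → 49 ^ (11 * r) * pᵏ ^ s * 2 ^ s) (size-adj v)) (sym βʳ))
      (trans (cong (λ s → 50 ^ (11 * r) * W ^ s) (size-adj v)) (sym αʳ))
      (chernoff (adj G v) b (11 * r))

  lopsided-rare : 28 ≤ r → ∀ v → 4 * (r * r) * count (lopsided v) ≤ 2 ^ n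
  lopsided-rare 28≤r v = *-cancelˡ-≤ 2 (begin
    2 * (4 * D * count (lopsided v))
      ≤⟨ *-monoʳ-≤ 2 (*-monoʳ-≤ (4 * D) (count-∪ (deficientAt v true) _)) ⟩
    2 * (4 * D * (X₁ + X₂))
      ≡⟨ distribute D X₁ X₂ ⟩
    8 * D * X₁ + 8 * D * X₂
      ≤⟨ +-mono-≤ (one-side-rare 28≤r v true) (one-side-rare 28≤r v false) ⟩
    2 ^ n + 2 ^ n
      ≡⟨ cong (2 ^ n +_) (+-identityʳ (2 ^ n)) ⟨
    2 * 2 ^ n ∎)
    where
    open ≤-Reasoning
    D = r * r
    X₁ = count (deficientAt v true)
    X₂ = count (deficientAt v false)
    distribute : ∀ D a b → 2 * (4 * D * (a + b)) ≡ 8 * D * a + 8 * D * b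
    distribute = solve-∀

lemma11 : (n r : ℕ) → (G : SimpleGraph n) → Regular G r → 28 ≤ r →
          Σ (Fin n → Bool) (λ c → (v : Fin n) →
            (11 * r ≤ 100 * neighboursIn G c v) ×
            (11 * r ≤ 100 * neighboursIn G (λ j → not (c j)) v))
lemma11 n r G regular 28≤r =
  c , λ v → balanced true  (∨-conicalˡ _ _ (avoids-lopsided v))
          , balanced false (∨-conicalʳ _ _ (avoids-lopsided v))
  where
  open Balanced G regular
  instance
    r≢0 : NonZero r
    r≢0 = >-nonZero (≤-trans (s≤s z≤n) 28≤r)
    r*r≢0 : NonZero (r * r)
    r*r≢0 = m*n≢0 r r
  open LocalLemma lopsided (adj G) lopsided-local (r * r) (lopsided-rare 28≤r) common-neighbours

  c : Colouring n
  c = proj₁ avoiding-colouring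
  avoids-lopsided : ∀ v → lopsided v c ≡ false
  avoids-lopsided = proj₂ avoiding-colouring
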